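{- Let $\mathcal{C}$ be a zerosumfree dagger additive category which additionally has dagger kernels. The fibration $\mathrm{pPred}(\mathcal{C})\to\dagger\text{ - }\mathrm{Mono}(\mathcal{C})$ of positive predicates then has comprehension: the truth functor $1$ has a right adjoint $\{ -\}$, given on a predicate $q=\langle q_1,q_2\rangle\colon Y\to Y\oplus Y$ by $\{q\}=\ker(q_2)=\ker(\mathrm{id}-q_1)=\mathrm{eq}(\mathrm{id},q_1)$.
   Context: In a dagger biproduct category ($\oplus$ biproducts with $(\pi_i)^\dagger=\kappa_i$), dagger additive if homsets have additive inverses, zerosumfree if $f+g=0\Rightarrow f=g=0$ for positive $f,g$ (positive meaning $g^\dagger\circ g$). A positive predicate on $X$ is $p=\langle p_1,p_2\rangle\colon X\to X\oplus X$ with $p_1+p_2=\mathrm{id}$ and $p_1,p_2$ positive; these form an effect algebra $\mathrm{pPred}(X)$ with $1=\kappa_1$, $0=\kappa_2$, orthocomplement by swapping, and partial sum $p\boxplus q=(\nabla+\mathrm{id})\circ b$ for a positive bound $b\colon X\to(X\oplus X)\oplus X$ with $[\mathrm{id},\kappa_2]\circ b=p$, $[[\kappa_2,\kappa_1],\kappa_2]\circ b=q$; order $p\le q$ iff $p\boxplus r=q$ for some $r$. For a dagger mono $f\colon X\rightarrowtail Y$ ($f^\dagger\circ f=\mathrm{id}$), substitution is $f^*(q)=(f^\dagger\oplus f^\dagger)\circ q\circ f$. $\mathrm{pPred}(\mathcal{C})$ has positive predicates as objects and maps $p\to q$ given by dagger monos $f$ with $p\le f^*(q)$; the truth functor $1\colon\dagger\text{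 - }\mathrm{Mono}(\mathcal{C})\to\mathrm{pPred}(\mathcal{C})$ sends $X$ to $\kappa_1\colon X\to X\oplus X$. A dagger kernel is a kernel that is a dagger mono. Here $\boxplus$ denotes the partial sum operation. -}

module Defs where

open import Level using (Level; _⊔_) renaming (suc to lsuc)
open import Data.Product using (Σ; _×_; _,_)
open import Relation.Binary using (Rel)
open import Algebra.Structures using (IsAbelianGroup)

record DaggerAdditiveCategory (o ℓ e : Level) : Set (lsuc (o ⊔ ℓ ⊔ e)) where
  infixr 9 _∘_
  infixl 6 _+_
  infix  4 _≈_
  infixr 7 _⊕_
  infix  5 _⇒_
  infix  30 _†
  field
    Obj  : Set o
    _⇒_  : Obj → Obj → Set ℓ
    _≈_  : ∀ {A B} → Rel (A ⇒ B) e
    id   : ∀ {A} → A ⇒ A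
    _∘_  : ∀ {A B C} → B ⇒ C → A ⇒ B → A ⇒ C
    -- abelian group enrichment (includes that _≈_ is an equivalence)
    0m   : ∀ {A B} → A ⇒ B
    _+_  : ∀ {A B} → A ⇒ B → A ⇒ B → A ⇒ B
    -_   : ∀ {A B} → A ⇒ B → A ⇒ B
    +-isAbelianGroup : ∀ {A B} → IsAbelianGroup (_≈_ {A} {B}) _+_ 0m -_
    assoc     : ∀ {A B C D} {f : A ⇒ B} {g : B ⇒ C} {h : C ⇒ D} →
                (h ∘ g) ∘ f ≈ h ∘ (g ∘ f)
    identityˡ : ∀ {A B} {f : A ⇒ B} → id ∘ f ≈ f
    identityʳ : ∀ {A B} {f : A ⇒ B} → f ∘ id ≈ f
    ∘-resp-≈  : ∀ {A B C} {f h : B ⇒ C} {g i : A ⇒ B} →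
                f ≈ h → g ≈ i → f ∘ g ≈ h ∘ i
    ∘-distribˡ : ∀ {A B C} {h : B ⇒ C} {f g : A ⇒ B} → h ∘ (f + g) ≈ h ∘ f + h ∘ g
    ∘-distribʳ : ∀ {A B C} {f g : B ⇒ C} {h : A ⇒ B} → (f + g) ∘ h ≈ f ∘ h + g ∘ h
    ∘-zeroˡ    : ∀ {A B C} {f : A ⇒ B} → (0m {B} {C}) ∘ f ≈ 0m
    ∘-zeroʳ    : ∀ {A B C} {f : B ⇒ C} → f ∘ (0m {A} {B}) ≈ 0m
    _†           : ∀ {A B} → A ⇒ B → B ⇒ A
    †-involutive : ∀ {A B} {f : A ⇒ B} → (f †) † ≈ f
    †-identity   : ∀ {A} → (id {A}) † ≈ id
    †-homomorphism : ∀ {A B C} {f : A ⇒ B} {g : B ⇒ C} → (g ∘ f) † ≈ f † ∘ g †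
    †-resp-≈     : ∀ {A B} {f g : A ⇒ B} → f ≈ g → f † ≈ g †
    𝟘        : Obj
    ¡-unique : ∀ {A} (f : 𝟘 ⇒ A) → f ≈ 0m
    !-unique : ∀ {A} (f : A ⇒ 𝟘) → f ≈ 0m
    _⊕_ : Obj → Obj → Obj
    π₁  : ∀ {A B} → A ⊕ B ⇒ A
    π₂  : ∀ {A B} → A ⊕ B ⇒ B
    κ₁  : ∀ {A B} → A ⇒ A ⊕ B
    κ₂  : ∀ {A B} → B ⇒ A ⊕ B
    π₁∘κ₁ : ∀ {A B} → π₁ {A} {B} ∘ κ₁ ≈ id
    π₂∘κ₂ : ∀ {A B} → π₂ {A} {B} ∘ κ₂ ≈ id
    π₁∘κ₂ : ∀ {A B} → π₁ {A} {B} ∘ κ₂ ≈ 0m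
    π₂∘κ₁ : ∀ {A B} → π₂ {A} {B} ∘ κ₁ ≈ 0m
    κπ-sum : ∀ {A B} → κ₁ ∘ π₁ {A} {B} + κ₂ ∘ π₂ ≈ id
    π₁-† : ∀ {A B} → (π₁ {A} {B}) † ≈ κ₁
    π₂-† : ∀ {A B} → (π₂ {A} {B}) † ≈ κ₂

module _ {o ℓ e} (C : DaggerAdditiveCategory o ℓ e) where
  open DaggerAdditiveCategory C

  [_,_] : ∀ {A B Z} → A ⇒ Z → B ⇒ Z → A ⊕ B ⇒ Z
  [ f , g ] = f ∘ π₁ + g ∘ π₂

  ⟨_,_⟩ : ∀ {Z A B} → Z ⇒ A → Z ⇒ B → Z ⇒ A ⊕ B
  ⟨ f , g ⟩ = κ₁ ∘ f + κ₂ ∘ g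

  infixr 7 _⊕₁_
  _⊕₁_ : ∀ {A B A' B'} → A ⇒ A' → B ⇒ B' → A ⊕ B ⇒ A' ⊕ B'
  f ⊕₁ g = κ₁ ∘ f ∘ π₁ + κ₂ ∘ g ∘ π₂

  ∇ : ∀ {A} → A ⊕ A ⇒ A
  ∇ = [ id , id ]

  Positive : ∀ {A} → A ⇒ A → Set (o ⊔ ℓ ⊔ e)
  Positive {A} f = Σ Obj λ Z → Σ (A ⇒ Z) λ g → f ≈ g † ∘ g

  Zerosumfree : Set (o ⊔ ℓ ⊔ e)
  Zerosumfree = ∀ {A} (f g : A ⇒ A) → Positive f → Positive g →
                f + g ≈ 0m → (f ≈ 0m) × (g ≈ 0m)

  IsDaggerMono : ∀ {A B} → A ⇒ B → Set e
  IsDaggerMono f = f † ∘ f ≈ id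

  IsKernel : ∀ {X Y K} → X ⇒ Y → K ⇒ X → Set (o ⊔ ℓ ⊔ e)
  IsKernel {X} {Y} {K} f k =
    (f ∘ k ≈ 0m) ×
    (∀ {Z} (g : Z ⇒ X) → f ∘ g ≈ 0m →
       Σ (Z ⇒ K) λ h → (k ∘ h ≈ g) × (∀ (h' : Z ⇒ K) → k ∘ h' ≈ g → h' ≈ h))

  IsDaggerKernel : ∀ {X Y K} → X ⇒ Y → K ⇒ X → Set (o ⊔ ℓ ⊔ e)
  IsDaggerKernel f k = IsKernel f k × IsDaggerMono k

  HasDaggerKernels : Set (o ⊔ ℓ ⊔ e)
  HasDaggerKernels = ∀ {X Y} (f : X ⇒ Y) → Σ Obj λ K → Σ (K ⇒ X) λ k → IsDaggerKernel f k

  IsEqualizer : ∀ {X Y E} → X ⇒ Y → X ⇒ Y → E ⇒ X → Set (o ⊔ ℓ ⊔ e)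
  IsEqualizer {X} {Y} {E} f g m =
    (f ∘ m ≈ g ∘ m) ×
    (∀ {Z} (h : Z ⇒ X) → f ∘ h ≈ g ∘ h →
       Σ (Z ⇒ E) λ u → (m ∘ u ≈ h) × (∀ (u' : Z ⇒ E) → m ∘ u' ≈ h → u' ≈ u))

  IsPosPred : ∀ {X} → X ⇒ X ⊕ X → Set (o ⊔ ℓ ⊔ e)
  IsPosPred p = (π₁ ∘ p + π₂ ∘ p ≈ id) × Positive (π₁ ∘ p) × Positive (π₂ ∘ p)

  IsPosBound : ∀ {X} → X ⇒ (X ⊕ X) ⊕ X → Set (o ⊔ ℓ ⊔ e)
  IsPosBound b =
    (π₁ ∘ π₁ ∘ b + π₂ ∘ π₁ ∘ b + π₂ ∘ b ≈ id) ×
    Positive (π₁ ∘ π₁ ∘ b) × Positive (π₂ ∘ π₁ ∘ b) × Positive (π₂ ∘ b)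

  IsSum : ∀ {X} → (p r s : X ⇒ X ⊕ X) → Set (o ⊔ ℓ ⊔ e)
  IsSum {X} p r s = Σ (X ⇒ (X ⊕ X) ⊕ X) λ b →
    IsPosBound b ×
    ([ id , κ₂ ] ∘ b ≈ p) ×
    ([ [ κ₂ , κ₁ ] , κ₂ ] ∘ b ≈ r) ×
    ((∇ ⊕₁ id) ∘ b ≈ s)

  _≤ₚ_ : ∀ {X} → X ⇒ X ⊕ X → X ⇒ X ⊕ X → Set (o ⊔ ℓ ⊔ e)
  _≤ₚ_ {X} p q = Σ (X ⇒ X ⊕ X) λ r → IsPosPred r × IsSum p r q

  _^* : ∀ {X Y} → X ⇒ Y → Y ⇒ Y ⊕ Y → X ⇒ X ⊕ X
  (f ^*) q = (f † ⊕₁ f †) ∘ q ∘ f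

  PPredHom : ∀ {X Y} → X ⇒ X ⊕ X → Y ⇒ Y ⊕ Y → X ⇒ Y → Set (o ⊔ ℓ ⊔ e)
  PPredHom p q f = IsDaggerMono f × (p ≤ₚ (f ^*) q)

  -- k : 1(K) → q is a universal arrow from the truth functor 1 to q,
  -- i.e. a counit component exhibiting K as the value {q} of a right adjoint of 1.
  IsComprehension : ∀ {Y K} → Y ⇒ Y ⊕ Y → K ⇒ Y → Set (o ⊔ ℓ ⊔ e)
  IsComprehension {Y} {K} q k =
    PPredHom (κ₁ {K} {K}) q k ×
    (∀ {X} (f : X ⇒ Y) → PPredHom (κ₁ {X} {X}) q f →
       Σ (X ⇒ K) λ g → IsDaggerMono g × (k ∘ g ≈ f) ×
         (∀ (g' : X ⇒ K) → IsDaggerMono g' → k ∘ g' ≈ f → g' ≈ g))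

module Submission where

-- Let q = ⟨q₁,q₂⟩ be a positive predicate on Y, so q₁ + q₂ = id, and let
-- k : K ↣ Y be a dagger kernel of q₂.
--  * Kernel and equalizer descriptions are pure algebra: since q₂ = id - q₁,
--    q₂ ∘ h = 0 holds exactly when h = q₁ ∘ h.
--  * k is a map 1(K) → q: k fixes q₁ and is killed by q₂, so the substitution
--    k*(q) is the truth predicate κ₁, and truth lies below itself.
--  * Universality: if f : 1(X) → q then κ₁ ≤ f*(q); the bound witnessing this
--    gives, by zerosumfreeness, that the second component f† q₂ f of f*(q)
--    vanishes. Since q₂ = h† h is positive and dagger kernels make the dagger
--    definite (g† g = 0 ⇒ g = 0), q₂ f = 0, so f factors uniquely through k,
--    and the factor is a dagger mono because k and f are.

open import Defs hiding ([_,_]; ⟨_,_⟩; _⊕₁_; ∇; _^*)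
import Defs
open import Data.Product using (_×_; _,_; Σ; proj₁; proj₂)
open import Algebra.Structures using (IsAbelianGroup)
import Relation.Binary.Reasoning.Setoid as SetoidReasoning

module Lemmas {o ℓ e} (C : DaggerAdditiveCategory o ℓ e) where
  open DaggerAdditiveCategory C
  module G {A B} = IsAbelianGroup (+-isAbelianGroup {A} {B})
  open G using (refl; sym; trans) renaming (∙-cong to +-cong)
  module ≈-Reasoning {A B} = SetoidReasoning (G.setoid {A} {B})
  open ≈-Reasoning

  [_,_] : ∀ {A B Z} → A ⇒ Z → B ⇒ Z → A ⊕ B ⇒ Z
  [_,_] = Defs.[_,_] C

  ⟨_,_⟩ : ∀ {Z A B} → Z ⇒ A → Z ⇒ B → Z ⇒ A ⊕ B
  ⟨_,_⟩ = Defs.⟨_,_⟩ C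

  infixr 7 _⊕₁_
  _⊕₁_ : ∀ {A B A' B'} → A ⇒ A' → B ⇒ B' → A ⊕ B ⇒ A' ⊕ B'
  _⊕₁_ = Defs._⊕₁_ C

  ∇ : ∀ {A} → A ⊕ A ⇒ A
  ∇ = Defs.∇ C

  _^* : ∀ {X Y} → X ⇒ Y → Y ⇒ Y ⊕ Y → X ⇒ X ⊕ X
  _^* = Defs._^* C

  ∘-resp-≈ʳ : ∀ {A B D} {f : B ⇒ D} {g h : A ⇒ B} → g ≈ h → f ∘ g ≈ f ∘ h
  ∘-resp-≈ʳ p = ∘-resp-≈ refl p

  ∘-resp-≈ˡ : ∀ {A B D} {f g : B ⇒ D} {h : A ⇒ B} → f ≈ g → f ∘ h ≈ g ∘ h
  ∘-resp-≈ˡ p = ∘-resp-≈ p refl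

  sym-assoc : ∀ {A B D E} {f : A ⇒ B} {g : B ⇒ D} {h : D ⇒ E} →
              h ∘ (g ∘ f) ≈ (h ∘ g) ∘ f
  sym-assoc = sym assoc

  -- The zero morphism is self-adjoint, as it factors through the zero object.
  †-zero : ∀ {A B} → (0m {A} {B}) † ≈ 0m
  †-zero {A} {B} = begin
    (0m {A} {B}) †                    ≈⟨ †-resp-≈ (sym (∘-zeroˡ {f = 0m {A} {𝟘}})) ⟩
    (0m {𝟘} {B} ∘ 0m {A} {𝟘}) †       ≈⟨ †-homomorphism ⟩
    (0m {A} {𝟘}) † ∘ (0m {𝟘} {B}) †   ≈⟨ ∘-resp-≈ʳ (!-unique _) ⟩
    (0m {A} {𝟘}) † ∘ 0m               ≈⟨ ∘-zeroʳ ⟩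
    0m                                ∎

  π₂∘⟨⟩ : ∀ {Z A B} {x : Z ⇒ A} {y : Z ⇒ B} → π₂ ∘ ⟨ x , y ⟩ ≈ y
  π₂∘⟨⟩ {x = x} {y} = begin
    π₂ ∘ (κ₁ ∘ x + κ₂ ∘ y)          ≈⟨ ∘-distribˡ ⟩
    π₂ ∘ (κ₁ ∘ x) + π₂ ∘ (κ₂ ∘ y)   ≈⟨ +-cong sym-assoc sym-assoc ⟩
    (π₂ ∘ κ₁) ∘ x + (π₂ ∘ κ₂) ∘ y   ≈⟨ +-cong (∘-resp-≈ˡ π₂∘κ₁) (∘-resp-≈ˡ π₂∘κ₂) ⟩
    0m ∘ x + id ∘ y                 ≈⟨ +-cong ∘-zeroˡ identityˡ ⟩
    0m + y                          ≈⟨ G.identityˡ y ⟩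
    y                               ∎

  []∘κ₁ : ∀ {A B Z} {f : A ⇒ Z} {g : B ⇒ Z} → [ f , g ] ∘ κ₁ ≈ f
  []∘κ₁ {f = f} {g} = begin
    (f ∘ π₁ + g ∘ π₂) ∘ κ₁          ≈⟨ ∘-distribʳ ⟩
    (f ∘ π₁) ∘ κ₁ + (g ∘ π₂) ∘ κ₁   ≈⟨ +-cong assoc assoc ⟩
    f ∘ (π₁ ∘ κ₁) + g ∘ (π₂ ∘ κ₁)   ≈⟨ +-cong (∘-resp-≈ʳ π₁∘κ₁) (∘-resp-≈ʳ π₂∘κ₁) ⟩
    f ∘ id + g ∘ 0m                 ≈⟨ +-cong identityʳ ∘-zeroʳ ⟩
    f + 0m                          ≈⟨ G.identityʳ f ⟩
    f                               ∎

  []∘κ₁∘ : ∀ {A B Z W} {f : A ⇒ Z} {g : B ⇒ Z} {x : W ⇒ A} →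
           [ f , g ] ∘ κ₁ ∘ x ≈ f ∘ x
  []∘κ₁∘ = trans sym-assoc (∘-resp-≈ˡ []∘κ₁)

  ⊕₁∘ : ∀ {A B A' B' W} {f : A ⇒ A'} {g : B ⇒ B'} {x : W ⇒ A ⊕ B} →
        (f ⊕₁ g) ∘ x ≈ ⟨ f ∘ π₁ ∘ x , g ∘ π₂ ∘ x ⟩
  ⊕₁∘ = trans ∘-distribʳ (+-cong (trans assoc (∘-resp-≈ʳ assoc))
                                 (trans assoc (∘-resp-≈ʳ assoc)))

  π₂∘⊕₁∘ : ∀ {A B A' B' W} {f : A ⇒ A'} {g : B ⇒ B'} {x : W ⇒ A ⊕ B} →
           π₂ ∘ (f ⊕₁ g) ∘ x ≈ g ∘ π₂ ∘ x
  π₂∘⊕₁∘ = trans (∘-resp-≈ʳ ⊕₁∘) π₂∘⟨⟩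

  ⊕₁∘κ₁ : ∀ {A B A' B'} {f : A ⇒ A'} {g : B ⇒ B'} → (f ⊕₁ g) ∘ κ₁ ≈ κ₁ ∘ f
  ⊕₁∘κ₁ {f = f} {g} = begin
    (f ⊕₁ g) ∘ κ₁                           ≈⟨ ⊕₁∘ ⟩
    κ₁ ∘ f ∘ π₁ ∘ κ₁ + κ₂ ∘ g ∘ π₂ ∘ κ₁     ≈⟨ +-cong (∘-resp-≈ʳ (∘-resp-≈ʳ π₁∘κ₁))
                                                      (∘-resp-≈ʳ (∘-resp-≈ʳ π₂∘κ₁)) ⟩
    κ₁ ∘ f ∘ id + κ₂ ∘ g ∘ 0m               ≈⟨ +-cong (∘-resp-≈ʳ identityʳ)
                                                      (trans (∘-resp-≈ʳ ∘-zeroʳ) ∘-zeroʳ) ⟩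
    κ₁ ∘ f + 0m                             ≈⟨ G.identityʳ _ ⟩
    κ₁ ∘ f                                  ∎

  π₂∘^* : ∀ {X Y} {f : X ⇒ Y} {q : Y ⇒ Y ⊕ Y} →
          π₂ ∘ (f ^*) q ≈ f † ∘ (π₂ ∘ q) ∘ f
  π₂∘^* = trans π₂∘⊕₁∘ (∘-resp-≈ʳ sym-assoc)

  zero-positive : ∀ {A} {f : A ⇒ A} → f ≈ 0m → Positive C f
  zero-positive p = 𝟘 , 0m , trans p (sym ∘-zeroʳ)

  id-positive : ∀ {A} {f : A ⇒ A} → f ≈ id → Positive C f
  id-positive {A} p = A , id , trans p (trans (sym identityˡ) (∘-resp-≈ˡ (sym †-identity)))

  daggerMono-factor : ∀ {X Y K} {k : K ⇒ Y} {g : X ⇒ K} {f : X ⇒ Y} →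
    IsDaggerMono C k → k ∘ g ≈ f → IsDaggerMono C f → IsDaggerMono C g
  daggerMono-factor {k = k} {g} {f} k-mono kg f-mono = begin
    g † ∘ g                ≈⟨ ∘-resp-≈ʳ (sym identityˡ) ⟩
    g † ∘ (id ∘ g)         ≈⟨ ∘-resp-≈ʳ (∘-resp-≈ˡ (sym k-mono)) ⟩
    g † ∘ ((k † ∘ k) ∘ g)  ≈⟨ ∘-resp-≈ʳ assoc ⟩
    g † ∘ (k † ∘ (k ∘ g))  ≈⟨ sym-assoc ⟩
    (g † ∘ k †) ∘ (k ∘ g)  ≈⟨ ∘-resp-≈ˡ (sym †-homomorphism) ⟩
    (k ∘ g) † ∘ (k ∘ g)    ≈⟨ ∘-resp-≈ (†-resp-≈ kg) kg ⟩
    f † ∘ f                ≈⟨ f-mono ⟩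
    id                     ∎

  kernel-resp : ∀ {X Y K} {f f' : X ⇒ Y} {k : K ⇒ X} →
    f ≈ f' → IsKernel C f k → IsKernel C f' k
  kernel-resp f≈f' (fk≈0 , factor) =
    trans (∘-resp-≈ˡ (sym f≈f')) fk≈0 , λ g f'g≈0 → factor g (trans (∘-resp-≈ˡ f≈f') f'g≈0)

  complement-difference : ∀ {A} {a b : A ⇒ A} → a + b ≈ id → b ≈ id + - a
  complement-difference {a = a} {b} a+b≈id = begin
    b                ≈⟨ sym (G.identityʳ b) ⟩
    b + 0m           ≈⟨ +-cong refl (sym (G.inverseʳ a)) ⟩
    b + (a + - a)    ≈⟨ sym (G.assoc _ _ _) ⟩
    (b + a) + - a    ≈⟨ +-cong (G.comm _ _) refl ⟩
    (a + b) + - a    ≈⟨ +-cong a+b≈id refl ⟩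
    id + - a         ∎

  complement-kills⇒fixed : ∀ {A Z} {a b : A ⇒ A} {h : Z ⇒ A} →
    a + b ≈ id → b ∘ h ≈ 0m → id ∘ h ≈ a ∘ h
  complement-kills⇒fixed {a = a} {b} {h} a+b≈id bh≈0 = begin
    id ∘ h           ≈⟨ ∘-resp-≈ˡ (sym a+b≈id) ⟩
    (a + b) ∘ h      ≈⟨ ∘-distribʳ ⟩
    a ∘ h + b ∘ h    ≈⟨ +-cong refl bh≈0 ⟩
    a ∘ h + 0m       ≈⟨ G.identityʳ _ ⟩
    a ∘ h            ∎

  fixed⇒complement-kills : ∀ {A Z} {a b : A ⇒ A} {h : Z ⇒ A} →
    a + b ≈ id → id ∘ h ≈ a ∘ h → b ∘ h ≈ 0m
  fixed⇒complement-kills {a = a} {b} {h} a+b≈id fixed = begin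
    b ∘ h                     ≈⟨ sym (G.identityˡ _) ⟩
    0m + b ∘ h                ≈⟨ +-cong (sym (G.inverseˡ h)) refl ⟩
    (- h + h) + b ∘ h         ≈⟨ G.assoc _ _ _ ⟩
    - h + (h + b ∘ h)         ≈⟨ +-cong refl (+-cong (trans (sym identityˡ) fixed) refl) ⟩
    - h + (a ∘ h + b ∘ h)     ≈⟨ +-cong refl (sym ∘-distribʳ) ⟩
    - h + (a + b) ∘ h         ≈⟨ +-cong refl (trans (∘-resp-≈ˡ a+b≈id) identityˡ) ⟩
    - h + h                   ≈⟨ G.inverseˡ h ⟩
    0m                        ∎

  kernel⇒equalizer : ∀ {A K} {a b : A ⇒ A} {k : K ⇒ A} →
    a + b ≈ id → IsKernel C b k → IsEqualizer C id a k
  kernel⇒equalizer a+b≈id (bk≈0 , factor) =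
    complement-kills⇒fixed a+b≈id bk≈0 ,
    λ h fixed → factor h (fixed⇒complement-kills a+b≈id fixed)

  -- With dagger kernels the dagger is definite: g† ∘ g = 0 forces g = 0.
  -- g factors as n ∘ u through the dagger kernel n of g†, and
  -- u = n† ∘ n ∘ u = n† ∘ g = (g† ∘ n)† = 0.
  dagger-definite : HasDaggerKernels C → ∀ {A B} (g : A ⇒ B) → g † ∘ g ≈ 0m → g ≈ 0m
  dagger-definite kernels g g†g≈0
    with kernels (g †)
  ... | _ , n , ((g†n≈0 , factor) , n-mono)
    with factor g g†g≈0
  ... | u , nu≈g , _ = begin
    g       ≈⟨ sym nu≈g ⟩
    n ∘ u   ≈⟨ ∘-resp-≈ʳ u≈0 ⟩
    n ∘ 0m  ≈⟨ ∘-zeroʳ ⟩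
    0m      ∎
    where
    u≈0 : u ≈ 0m
    u≈0 = begin
      u                 ≈⟨ sym identityˡ ⟩
      id ∘ u            ≈⟨ ∘-resp-≈ˡ (sym n-mono) ⟩
      (n † ∘ n) ∘ u     ≈⟨ assoc ⟩
      n † ∘ (n ∘ u)     ≈⟨ ∘-resp-≈ʳ nu≈g ⟩
      n † ∘ g           ≈⟨ ∘-resp-≈ʳ (sym †-involutive) ⟩
      n † ∘ (g †) †     ≈⟨ sym †-homomorphism ⟩
      (g † ∘ n) †       ≈⟨ †-resp-≈ g†n≈0 ⟩
      0m †              ≈⟨ †-zero ⟩
      0m                ∎

  -- A positive a = h† ∘ h is killed by f as soon as f† ∘ a ∘ f = 0,
  -- because then (h ∘ f)† ∘ (h ∘ f) = 0.
  positive-sandwich : HasDaggerKernels C → ∀ {A X} {a : A ⇒ A} {f : X ⇒ A} →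
    Positive C a → f † ∘ a ∘ f ≈ 0m → a ∘ f ≈ 0m
  positive-sandwich kernels {a = a} {f} (_ , h , a≈h†h) f†af≈0 = begin
    a ∘ f           ≈⟨ ∘-resp-≈ˡ a≈h†h ⟩
    (h † ∘ h) ∘ f   ≈⟨ assoc ⟩
    h † ∘ (h ∘ f)   ≈⟨ ∘-resp-≈ʳ hf≈0 ⟩
    h † ∘ 0m        ≈⟨ ∘-zeroʳ ⟩
    0m              ∎
    where
    hf≈0 : h ∘ f ≈ 0m
    hf≈0 = dagger-definite kernels (h ∘ f) (begin
      (h ∘ f) † ∘ (h ∘ f)     ≈⟨ ∘-resp-≈ˡ †-homomorphism ⟩
      (f † ∘ h †) ∘ (h ∘ f)   ≈⟨ assoc ⟩
      f † ∘ (h † ∘ (h ∘ f))   ≈⟨ ∘-resp-≈ʳ sym-assoc ⟩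
      f † ∘ ((h † ∘ h) ∘ f)   ≈⟨ ∘-resp-≈ʳ (∘-resp-≈ˡ (sym a≈h†h)) ⟩
      f † ∘ a ∘ f             ≈⟨ f†af≈0 ⟩
      0m                      ∎)

  substitution-truth : ∀ {Y K} {q : Y ⇒ Y ⊕ Y} {k : K ⇒ Y} → IsDaggerMono C k →
    (π₁ ∘ q) ∘ k ≈ k → (π₂ ∘ q) ∘ k ≈ 0m → (k ^*) q ≈ κ₁
  substitution-truth {q = q} {k} k-mono q₁k≈k q₂k≈0 = begin
    (k † ⊕₁ k †) ∘ q ∘ k                                  ≈⟨ ⊕₁∘ ⟩
    κ₁ ∘ k † ∘ π₁ ∘ q ∘ k + κ₂ ∘ k † ∘ π₂ ∘ q ∘ k         ≈⟨ +-cong (∘-resp-≈ʳ (∘-resp-≈ʳ sym-assoc))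
                                                                   (∘-resp-≈ʳ (∘-resp-≈ʳ sym-assoc)) ⟩
    κ₁ ∘ k † ∘ (π₁ ∘ q) ∘ k + κ₂ ∘ k † ∘ (π₂ ∘ q) ∘ k     ≈⟨ +-cong (∘-resp-≈ʳ (∘-resp-≈ʳ q₁k≈k))
                                                                   (∘-resp-≈ʳ (∘-resp-≈ʳ q₂k≈0)) ⟩
    κ₁ ∘ k † ∘ k + κ₂ ∘ k † ∘ 0m                          ≈⟨ +-cong (∘-resp-≈ʳ k-mono)
                                                                   (trans (∘-resp-≈ʳ ∘-zeroʳ) ∘-zeroʳ) ⟩
    κ₁ ∘ id + 0m                                          ≈⟨ trans (G.identityʳ _) identityʳ ⟩
    κ₁                                                    ∎

  truth-≤ : ∀ {X} {s : X ⇒ X ⊕ X} → s ≈ κ₁ → _≤ₚ_ C κ₁ s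
  truth-≤ {X} {s} s≈κ₁ =
    κ₂ , (falsity-sum , zero-positive π₁∘κ₂ , id-positive π₂∘κ₂) ,
    b , bound , trans []∘κ₁∘ identityˡ , trans []∘κ₁∘ []∘κ₁ , sum
    where
    b : X ⇒ (X ⊕ X) ⊕ X
    b = κ₁ ∘ κ₁

    π₁∘b : π₁ ∘ b ≈ κ₁
    π₁∘b = trans sym-assoc (trans (∘-resp-≈ˡ π₁∘κ₁) identityˡ)

    π₂∘b : π₂ ∘ b ≈ 0m
    π₂∘b = trans sym-assoc (trans (∘-resp-≈ˡ π₂∘κ₁) ∘-zeroˡ)

    falsity-sum : π₁ ∘ κ₂ + π₂ ∘ κ₂ ≈ id {X}
    falsity-sum = trans (+-cong π₁∘κ₂ π₂∘κ₂) (G.identityˡ _)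

    bound : IsPosBound C b
    bound = trans (+-cong (+-cong (trans (∘-resp-≈ʳ π₁∘b) π₁∘κ₁) (trans (∘-resp-≈ʳ π₁∘b) π₂∘κ₁)) π₂∘b)
                  (trans (G.identityʳ _) (G.identityʳ _)) ,
            id-positive (trans (∘-resp-≈ʳ π₁∘b) π₁∘κ₁) ,
            zero-positive (trans (∘-resp-≈ʳ π₁∘b) π₂∘κ₁) ,
            zero-positive π₂∘b

    sum : (∇ ⊕₁ id) ∘ b ≈ s
    sum = begin
      (∇ ⊕₁ id) ∘ κ₁ ∘ κ₁     ≈⟨ sym-assoc ⟩
      ((∇ ⊕₁ id) ∘ κ₁) ∘ κ₁   ≈⟨ ∘-resp-≈ˡ ⊕₁∘κ₁ ⟩
      (κ₁ ∘ ∇) ∘ κ₁           ≈⟨ assoc ⟩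
      κ₁ ∘ ∇ ∘ κ₁             ≈⟨ ∘-resp-≈ʳ []∘κ₁ ⟩
      κ₁ ∘ id                 ≈⟨ identityʳ ⟩
      κ₁                      ≈⟨ sym s≈κ₁ ⟩
      s                       ∎

  -- In a zerosumfree category truth ≤ s forces the second component of s to
  -- vanish: the bound b of 1 ⊞ r = s has b₂ + b₃ = π₂ ∘ κ₁ = 0, hence b₃ = 0,
  -- and b₃ is the second component of s.
  truth-≤⇒π₂≈0 : Zerosumfree C → ∀ {X} {s : X ⇒ X ⊕ X} → _≤ₚ_ C κ₁ s → π₂ ∘ s ≈ 0m
  truth-≤⇒π₂≈0 zsf {s = s} (_ , _ , b , (_ , _ , b₂-pos , b₃-pos) , b-left≈κ₁ , _ , b-sum) =
    begin
    π₂ ∘ s               ≈⟨ ∘-resp-≈ʳ (sym b-sum) ⟩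
    π₂ ∘ (∇ ⊕₁ id) ∘ b   ≈⟨ π₂∘⊕₁∘ ⟩
    id ∘ π₂ ∘ b          ≈⟨ identityˡ ⟩
    π₂ ∘ b               ≈⟨ proj₂ (zsf _ _ b₂-pos b₃-pos b₂+b₃≈0) ⟩
    0m                   ∎
    where
    π₂∘left : π₂ ∘ [ id , κ₂ ] ∘ b ≈ π₂ ∘ π₁ ∘ b + π₂ ∘ b
    π₂∘left = begin
      π₂ ∘ [ id , κ₂ ] ∘ b                          ≈⟨ ∘-resp-≈ʳ ∘-distribʳ ⟩
      π₂ ∘ ((id ∘ π₁) ∘ b + (κ₂ ∘ π₂) ∘ b)          ≈⟨ ∘-distribˡ ⟩
      π₂ ∘ (id ∘ π₁) ∘ b + π₂ ∘ (κ₂ ∘ π₂) ∘ b       ≈⟨ +-cong (∘-resp-≈ʳ (trans assoc identityˡ))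
                                                        (trans (∘-resp-≈ʳ assoc)
                                                          (trans sym-assoc (trans (∘-resp-≈ˡ π₂∘κ₂) identityˡ))) ⟩
      π₂ ∘ π₁ ∘ b + π₂ ∘ b                          ∎

    b₂+b₃≈0 : π₂ ∘ π₁ ∘ b + π₂ ∘ b ≈ 0m
    b₂+b₃≈0 = trans (sym π₂∘left) (trans (∘-resp-≈ʳ b-left≈κ₁) π₂∘κ₁)

  -- A morphism f : 1(X) → q of predicates lands in the kernel of q₂:
  -- f† ∘ q₂ ∘ f is the second component of f*(q) ≥ 1, hence zero, and q₂ is positive.
  truth-map-kills-q₂ : Zerosumfree C → HasDaggerKernels C →
    ∀ {X Y} {q : Y ⇒ Y ⊕ Y} {f : X ⇒ Y} →
    Positive C (π₂ ∘ q) → PPredHom C κ₁ q f → (π₂ ∘ q) ∘ f ≈ 0m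
  truth-map-kills-q₂ zsf kernels q₂-pos (_ , truth≤f*q) =
    positive-sandwich kernels q₂-pos (trans (sym π₂∘^*) (truth-≤⇒π₂≈0 zsf truth≤f*q))

proposition6p6 : ∀ {o ℓ e} (C : DaggerAdditiveCategory o ℓ e) →
    Zerosumfree C → HasDaggerKernels C →
    let open DaggerAdditiveCategory C in
    ∀ {Y} (q : Y ⇒ Y ⊕ Y) → IsPosPred C q →
    ∀ {K} (k : K ⇒ Y) → IsDaggerKernel C (π₂ ∘ q) k →
    IsComprehension C q k ×
    IsKernel C (id + (- (π₁ ∘ q))) k ×
    IsEqualizer C id (π₁ ∘ q) k
proposition6p6 C zsf kernels {Y} q (q₁+q₂≈id , _ , q₂-pos) {K} k (k-kernel@(q₂k≈0 , factor) , k-mono) =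
  (counit , universal) ,
  kernel-resp (complement-difference q₁+q₂≈id) k-kernel ,
  k-equalizer
  where
  open DaggerAdditiveCategory C
  open Lemmas C

  k-equalizer : IsEqualizer C id (π₁ ∘ q) k
  k-equalizer = kernel⇒equalizer q₁+q₂≈id k-kernel

  q₁k≈k : (π₁ ∘ q) ∘ k ≈ k
  q₁k≈k = G.trans (G.sym (proj₁ k-equalizer)) identityˡ

  counit : PPredHom C κ₁ q k
  counit = k-mono , truth-≤ (substitution-truth k-mono q₁k≈k q₂k≈0)

  universal : ∀ {X} (f : X ⇒ Y) → PPredHom C κ₁ q f →
    Σ (X ⇒ K) λ g → IsDaggerMono C g × (k ∘ g ≈ f) ×
      (∀ (g' : X ⇒ K) → IsDaggerMono C g' → k ∘ g' ≈ f → g' ≈ g)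
  universal f f-hom@(f-mono , _) with factor f (truth-map-kills-q₂ zsf kernels q₂-pos f-hom)
  ... | g , kg≈f , unique = g , daggerMono-factor k-mono kg≈f f-mono , kg≈f , λ g' _ → unique g'
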